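{- Let $n\geq 3$ be an integer with distinct prime divisors $p_1,\dots,p_t$, and let $1\leq d<n$. For $S\subseteq\{p_1,\dots,p_t\}$ put $n_S=n/\prod_{p\in S}p$ (with the empty product equal to $1$). Then: (i) $\alpha_n^d=\beta_n^d+\sum_{\emptyset\neq S\subseteq\{p_1,\dots,p_t\}}(-1)^{|S|+1}\alpha_{n_S}^d$ and $\beta_n^d=\sum_{S\subseteq\{p_1,\dots,p_t\}}(-1)^{|S|}\alpha_{n_S}^d$. In particular, $\phi(n)=\beta_n^1=\sum_{S\subseteq\{p_1,\dots,p_t\}}(-1)^{|S|}(n_S-1)$. (ii) If $n=p^t$ for a prime $p$ and a positive integer $t$, then $\alpha_{p^t}^d=\beta_{p^t}^d+\alpha_{p^{t-1}}^d$. (iii) If $n=p_1p_2$ for two distinct primes $p_1,p_2$, then $\alpha_{p_1p_2}^d=\beta_{p_1p_2}^d+\alpha_{p_1}^d+\alpha_{p_2}^d$.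
   Context: For a positive integer $m$, $\mathbb{Z}_m$ is the ring of integers modulo $m$, identified with $\{0,1,\dots,m-1\}$. A vector $(v_1,\dots,v_d)\in\mathbb{Z}_m^d$ is zero-sum-free if no non-empty subset of its components sums to $0$ in $\mathbb{Z}_m$; $\alpha_m^d$ is the number of zero-sum-free $d$-tuples in $\mathbb{Z}_m^d$. $\beta_m^d$ is the number of zero-sum-free $d$-tuples $(x_1,\dots,x_d)\in\mathbb{Z}_m^d$ with $\gcd(x_1,\dots,x_d,m)=1$. $\phi$ is Euler's totient function. -}

module Defs where

open import Data.Nat using (ℕ; zero; suc; _+_; _*_; _∸_; _^_; _≤_; _<_; _≥_; _≤?_; _≟_)
open import Data.Nat.DivMod using (_%_; _/_)
open import Data.Nat.GCD using (gcd)
open import Data.Nat.Divisibility using (_∣?_)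
open import Data.Nat.Primality using (prime?)
open import Data.Integer as ℤ using (ℤ; +_; -_)
open import Data.List using (List; []; _∷_; map; _++_; filter; length; upTo; concatMap)
open import Data.Nat.ListAction using (sum; product)
import Data.List as L
open import Data.List.Relation.Unary.All as All using (All)
open import Data.Vec as V using (Vec; []; _∷_; toList)
open import Relation.Nullary using (¬_; Dec)
open import Relation.Nullary.Decidable using (¬?; _×-dec_)
open import Relation.Binary.PropositionalEquality using (_≡_; _≢_)

-- All sublists of a list, selected by position (so this enumerates the
-- 2^(length xs) index subsets, with repeated entries kept distinct).
sublists : {A : Set} → List A → List (List A)
sublists []       = [] ∷ []
sublists (x ∷ xs) = map (x ∷_) (sublists xs) ++ sublists xs

nonempty? : {A : Set} → (xs : List A) → Dec (1 ≤ length xs)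
nonempty? xs = 1 ≤? length xs

nonemptySubsets : {A : Set} → List A → List (List A)
nonemptySubsets xs = filter nonempty? (sublists xs)

-- residue of x modulo m  (m = 0 never used; we put x itself)
_mod_ : ℕ → ℕ → ℕ
x mod zero    = x
x mod (suc k) = x % suc k

-- All d-tuples in Z_m^d, with Z_m identified with {0,…,m-1}.
tuples : ℕ → (d : ℕ) → List (Vec ℕ d)
tuples m zero    = [] ∷ []
tuples m (suc d) = concatMap (λ x → map (x ∷_) (tuples m d)) (upTo m)

ZeroSumFree : ℕ → {d : ℕ} → Vec ℕ d → Set
ZeroSumFree m v = All (λ s → sum s mod m ≢ 0) (nonemptySubsets (toList v))

zeroSumFree? : (m : ℕ) → {d : ℕ} → (v : Vec ℕ d) → Dec (ZeroSumFree m v)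
zeroSumFree? m v = All.all? (λ s → ¬? ((sum s mod m) ≟ 0)) (nonemptySubsets (toList v))

GcdOne : ℕ → {d : ℕ} → Vec ℕ d → Set
GcdOne m v = V.foldr (λ _ → ℕ) gcd m v ≡ 1

gcdOne? : (m : ℕ) → {d : ℕ} → (v : Vec ℕ d) → Dec (GcdOne m v)
gcdOne? m v = V.foldr (λ _ → ℕ) gcd m v ≟ 1

α : ℕ → ℕ → ℕ
α m d = length (filter (zeroSumFree? m) (tuples m d))

β : ℕ → ℕ → ℕ
β m d = length (filter (λ v → zeroSumFree? m v ×-dec gcdOne? m v) (tuples m d))

φ : ℕ → ℕ
φ n = length (filter (λ k → gcd k n ≟ 1) (map suc (upTo n)))

primeDivisors : ℕ → List ℕ
primeDivisors n = filter (λ p → prime? p ×-dec p ∣? n) (upTo (suc n))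

-- integer division with divisor 0 mapped to 0 (never used with 0 here)
_div_ : ℕ → ℕ → ℕ
x div zero    = 0
x div (suc k) = x / suc k

nS : ℕ → List ℕ → ℕ
nS n S = n div product S

neg1^ : ℕ → ℤ
neg1^ zero    = + 1
neg1^ (suc k) = - neg1^ k

Σℤ : {A : Set} → List A → (A → ℤ) → ℤ
Σℤ xs f = L.foldr (λ x acc → f x ℤ.+ acc) (+ 0) xs

-- Sort the zero-sum-free tuples of ℤ_n^d by the prime divisors p of n that divide every entry.
-- gcd(x₁,…,x_d,n) = 1 says that there is no such p, so β_n^d is an inclusion–exclusion sum over
-- sets S of prime divisors of n.  A tuple all of whose entries are divisible by ∏S is ∏S·y for a
-- unique y ∈ ℤ_{n_S}^d, and multiplication by ∏S both preserves and reflects zero-sum-freeness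
-- (∏S·n_S ∣ ∏S·s iff n_S ∣ s), so there are exactly α_{n_S}^d of them.  Splitting off the S = ∅
-- term gives the formula for α_n^d; for d = 1 it gives φ since α_m^1 = m − 1; and for n = p^t and
-- n = p₁p₂ the sum has one, resp. three, terms, where α_1^d = 0.
module Submission where

open import Defs
open import Data.Nat
  using (ℕ; zero; suc; _≤_; _<_; _^_; _*_; _∸_; _+_; s≤s; z≤n; NonZero; _≟_; ≢-nonZero; ≢-nonZero⁻¹; nonTrivial⇒≢1)
open import Data.Nat.Properties
  using (≤-trans; <⇒≱; +-identityʳ; +-suc; +-comm; *-comm; *-identityˡ; *-identityʳ; *-zeroʳ; *-suc; *-distribˡ-+;
         m^n≡0⇒m≡0; m*n≡0⇒m≡0∨n≡0)
open import Data.Nat.Divisibility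
open import Data.Nat.DivMod using (n/1≡n; n%1≡0; m*[n/m]≡n; m*n/n≡m)
open import Data.Nat.GCD using (gcd; gcd[m,n]∣m; gcd[m,n]∣n; gcd-greatest)
open import Data.Nat.LCM using (lcm; lcm-least; gcd*lcm)
open import Data.Nat.Coprimality using (Coprime; coprime⇒gcd≡1)
open import Data.Nat.Primality
  using (Prime; prime?; euclidsLemma; prime⇒irreducible; prime⇒nonZero; prime⇒nonTrivial; productOfPrimes≢0)
open import Data.Nat.Primality.Factorisation using (factorise; factorisationHasAllPrimeFactors)
open import Data.Nat.ListAction using (sum; product)
open import Data.Nat.ListAction.Properties using (∈⇒∣product)
open import Data.Integer as ℤ using (ℤ; +_; -_)
import Data.Integer.Properties as ℤP
open import Data.Integer.Solver using (module +-*-Solver)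
open import Data.List using (List; []; _∷_; [_]; _++_; _∷ʳ_; map; filter; length; upTo; applyUpTo; concatMap)
open import Data.List.Properties
  using (filter-accept; filter-reject; filter-all; filter-none; filter-++; filter-≐; map-++; map-∘; length-map;
         length-applyUpTo; applyUpTo-∷ʳ; upTo-∷ʳ; map-upTo; ++-assoc; ++-identityʳ)
open import Data.List.Membership.Propositional using (_∈_)
open import Data.List.Membership.Propositional.Properties using (∈-filter⁺; ∈-filter⁻; ∈-upTo⁺; ∈-++⁺ˡ; ∈-map⁺)
open import Data.List.Relation.Unary.All as All using (All; []; _∷_)
import Data.List.Relation.Unary.All.Properties as All
open import Data.List.Relation.Unary.AllPairs using ([]; _∷_)
open import Data.List.Relation.Unary.Any using (here; there)
open import Data.List.Relation.Unary.Unique.Propositional using (Unique)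
import Data.List.Relation.Unary.Unique.Propositional.Properties as Unique
open import Data.Vec as V using (Vec; []; _∷_; toList)
open import Data.Vec.Properties using (toList-map)
open import Data.Product using (_×_; _,_; swap; proj₁; proj₂; ∃-syntax)
open import Data.Sum using (_⊎_; inj₁; inj₂; [_,_]′)
open import Function using (id; _∘_; case_of_; _⇔_; mk⇔; Equivalence)
import Function.Properties.Equivalence as ⇔
open import Relation.Nullary using (¬_; yes; no; contradiction)
open import Relation.Nullary.Decidable using (¬?; _×-dec_; decidable-stable)
open import Relation.Unary using (Pred; Decidable)
open import Relation.Unary.Properties using (_∩?_; ∁?)
open import Relation.Binary.PropositionalEquality
  using (_≡_; _≢_; refl; sym; trans; cong; cong₂; subst; module ≡-Reasoning)
open import Level using (0ℓ)

open Equivalence using (to; from)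
open ≡-Reasoning

private
  variable
    A B : Set
    P Q : Pred A 0ℓ

filter-⇔ : (P? : Decidable P) (Q? : Decidable Q) → (∀ x → P x ⇔ Q x) → ∀ xs → filter P? xs ≡ filter Q? xs
filter-⇔ P? Q? P⇔Q = filter-≐ P? Q? ((λ {x} → to (P⇔Q x)) , (λ {x} → from (P⇔Q x)))

filter-filter : (P? : Decidable P) (Q? : Decidable Q) → ∀ xs → filter Q? (filter P? xs) ≡ filter (P? ∩? Q?) xs
filter-filter P? Q? []       = refl
filter-filter P? Q? (x ∷ xs) with P? x | Q? x
... | yes _ | yes q = trans (filter-accept Q? q) (cong (x ∷_) (filter-filter P? Q? xs))
... | yes _ | no ¬q = trans (filter-reject Q? ¬q) (filter-filter P? Q? xs)
... | no  _ | _     = filter-filter P? Q? xs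

filter-comm : (P? : Decidable P) (Q? : Decidable Q) → ∀ xs → filter Q? (filter P? xs) ≡ filter P? (filter Q? xs)
filter-comm P? Q? xs = begin
  filter Q? (filter P? xs)  ≡⟨ filter-filter P? Q? xs ⟩
  filter (P? ∩? Q?) xs      ≡⟨ filter-⇔ (P? ∩? Q?) (Q? ∩? P?) (λ _ → mk⇔ swap swap) xs ⟩
  filter (Q? ∩? P?) xs      ≡⟨ filter-filter Q? P? xs ⟨
  filter P? (filter Q? xs)  ∎

length-filter+length-filter-∁ : (P? : Decidable P) →
  ∀ xs → length xs ≡ length (filter P? xs) + length (filter (∁? P?) xs)
length-filter+length-filter-∁ P? []       = refl
length-filter+length-filter-∁ P? (x ∷ xs) with P? x
... | yes _ = cong suc (length-filter+length-filter-∁ P? xs)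
... | no  _ = trans (cong suc (length-filter+length-filter-∁ P? xs)) (sym (+-suc _ _))

filter-map : (P? : Decidable P) (f : A → _) → ∀ xs → filter P? (map f xs) ≡ map f (filter (P? ∘ f) xs)
filter-map P? f []       = refl
filter-map P? f (x ∷ xs) with P? (f x)
... | yes _ = cong (f x ∷_) (filter-map P? f xs)
... | no  _ = filter-map P? f xs

applyUpTo-+ : (f : ℕ → A) → ∀ m n → applyUpTo f (m + n) ≡ applyUpTo f m ++ applyUpTo (λ i → f (m + i)) n
applyUpTo-+ f zero    n = refl
applyUpTo-+ f (suc m) n = cong (f 0 ∷_) (applyUpTo-+ (f ∘ suc) m n)

∈-sublists : (xs : List A) → xs ∈ sublists xs
∈-sublists []       = here refl
∈-sublists (x ∷ xs) = ∈-++⁺ˡ (∈-map⁺ (x ∷_) (∈-sublists xs))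

sublists⁺ : ∀ {xs} → All P xs → All (All P) (sublists xs)
sublists⁺ []         = [] ∷ []
sublists⁺ (px ∷ pxs) = All.++⁺ (All.map⁺ (All.map (px ∷_) (sublists⁺ pxs))) (sublists⁺ pxs)

sublists-Unique⁺ : {xs : List A} → Unique xs → All Unique (sublists xs)
sublists-Unique⁺ []            = [] ∷ []
sublists-Unique⁺ (x∉xs ∷ uniq) =
  All.++⁺ (All.map⁺ (All.zipWith (λ (x∉S , uniqS) → x∉S ∷ uniqS) (sublists⁺ x∉xs , sublists-Unique⁺ uniq)))
          (sublists-Unique⁺ uniq)

sublists-map : (f : A → B) → ∀ xs → sublists (map f xs) ≡ map (map f) (sublists xs)
sublists-map f []       = refl
sublists-map f (x ∷ xs) = begin
  map (f x ∷_) (sublists (map f xs)) ++ sublists (map f xs)  ≡⟨ cong (λ L → map (f x ∷_) L ++ L) (sublists-map f xs) ⟩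
  map (f x ∷_) (map (map f) S) ++ map (map f) S              ≡⟨ cong (_++ map (map f) S) (trans (sym (map-∘ S)) (map-∘ S)) ⟩
  map (map f) (map (x ∷_) S) ++ map (map f) S                ≡⟨ map-++ (map f) (map (x ∷_) S) S ⟨
  map (map f) (map (x ∷_) S ++ S)                            ∎
  where S = sublists xs

nonemptySubsets-map : (f : A → B) → ∀ xs → nonemptySubsets (map f xs) ≡ map (map f) (nonemptySubsets xs)
nonemptySubsets-map f xs = begin
  filter nonempty? (sublists (map f xs))                  ≡⟨ cong (filter nonempty?) (sublists-map f xs) ⟩
  filter nonempty? (map (map f) (sublists xs))            ≡⟨ filter-map nonempty? (map f) (sublists xs) ⟩
  map (map f) (filter (nonempty? ∘ map f) (sublists xs))
    ≡⟨ cong (map (map f)) (filter-⇔ (nonempty? ∘ map f) nonempty? length-map⇔ (sublists xs)) ⟩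
  map (map f) (nonemptySubsets xs)                        ∎
  where
  length-map⇔ : ∀ s → 1 ≤ length (map f s) ⇔ 1 ≤ length s
  length-map⇔ s = mk⇔ (subst (1 ≤_) (length-map f s)) (subst (1 ≤_) (sym (length-map f s)))

sublists≡nonemptySubsets∷ʳ[] : (xs : List A) → sublists xs ≡ nonemptySubsets xs ∷ʳ []
sublists≡nonemptySubsets∷ʳ[] []       = refl
sublists≡nonemptySubsets∷ʳ[] (x ∷ xs) = begin
  map (x ∷_) S ++ S
    ≡⟨ cong (map (x ∷_) S ++_) (sublists≡nonemptySubsets∷ʳ[] xs) ⟩
  map (x ∷_) S ++ (nonemptySubsets xs ∷ʳ [])
    ≡⟨ ++-assoc (map (x ∷_) S) (nonemptySubsets xs) [ [] ] ⟨
  (map (x ∷_) S ++ nonemptySubsets xs) ∷ʳ []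
    ≡⟨ cong (λ L → (L ++ nonemptySubsets xs) ∷ʳ []) x∷S-nonempty ⟨
  (filter nonempty? (map (x ∷_) S) ++ nonemptySubsets xs) ∷ʳ []
    ≡⟨ cong (_∷ʳ []) (filter-++ nonempty? (map (x ∷_) S) S) ⟨
  nonemptySubsets (x ∷ xs) ∷ʳ [] ∎
  where
  S = sublists xs
  x∷S-nonempty : filter nonempty? (map (x ∷_) S) ≡ map (x ∷_) S
  x∷S-nonempty = filter-all nonempty? (All.map⁺ (All.universal (λ _ → s≤s z≤n) S))

Σℤ-++ : ∀ xs ys (f : A → ℤ) → Σℤ (xs ++ ys) f ≡ Σℤ xs f ℤ.+ Σℤ ys f
Σℤ-++ []       ys f = sym (ℤP.+-identityˡ _)
Σℤ-++ (x ∷ xs) ys f = trans (cong (λ s → f x ℤ.+ s) (Σℤ-++ xs ys f)) (sym (ℤP.+-assoc (f x) _ _))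

Σℤ-neg : ∀ xs (f : A → ℤ) → Σℤ xs (-_ ∘ f) ≡ - Σℤ xs f
Σℤ-neg []       f = refl
Σℤ-neg (x ∷ xs) f = trans (cong (λ s → - f x ℤ.+ s) (Σℤ-neg xs f)) (sym (ℤP.neg-distrib-+ (f x) _))

Σℤ-map : (g : B → A) → ∀ xs (f : A → ℤ) → Σℤ (map g xs) f ≡ Σℤ xs (f ∘ g)
Σℤ-map g []       f = refl
Σℤ-map g (x ∷ xs) f = cong (λ s → f (g x) ℤ.+ s) (Σℤ-map g xs f)

Σℤ-cong : ∀ {xs} {f g : A → ℤ} → All (λ x → f x ≡ g x) xs → Σℤ xs f ≡ Σℤ xs g
Σℤ-cong []            = refl
Σℤ-cong (fx≡gx ∷ eqs) = cong₂ ℤ._+_ fx≡gx (Σℤ-cong eqs)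

Σℤ-sublists : ∀ xs (f : List A → ℤ) → Σℤ (sublists xs) f ≡ Σℤ (nonemptySubsets xs) f ℤ.+ f []
Σℤ-sublists xs f = begin
  Σℤ (sublists xs) f                  ≡⟨ cong (λ L → Σℤ L f) (sublists≡nonemptySubsets∷ʳ[] xs) ⟩
  Σℤ (nonemptySubsets xs ∷ʳ []) f     ≡⟨ Σℤ-++ (nonemptySubsets xs) [ [] ] f ⟩
  X ℤ.+ (f [] ℤ.+ + 0)                ≡⟨ cong (λ y → X ℤ.+ y) (ℤP.+-identityʳ (f [])) ⟩
  X ℤ.+ f []                          ∎
  where X = Σℤ (nonemptySubsets xs) f

module InclusionExclusion {I X : Set} {R : I → Pred X 0ℓ} (R? : ∀ i → Decidable (R i)) where

  all? : (S : List I) → Decidable (λ x → All (λ i → R i x) S)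
  all? S x = All.all? (λ i → R? i x) S

  none? : (S : List I) → Decidable (λ x → All (λ i → ¬ R i x) S)
  none? S x = All.all? (λ i → ¬? (R? i x)) S

  signedCount : List X → List I → ℤ
  signedCount xs S = neg1^ (length S) ℤ.* + length (filter (all? S) xs)

  signedCount-∷ : ∀ xs i S → signedCount xs (i ∷ S) ≡ - signedCount (filter (R? i) xs) S
  signedCount-∷ xs i S = trans (cong (λ L → - neg1^ (length S) ℤ.* + length L) all-∷)
                               (sym (ℤP.neg-distribˡ-* (neg1^ (length S)) _))
    where
    all-∷ : filter (all? (i ∷ S)) xs ≡ filter (all? S) (filter (R? i) xs)
    all-∷ = trans (filter-⇔ (all? (i ∷ S)) (R? i ∩? all? S) (λ _ → mk⇔ All.uncons (λ (r , a) → r ∷ a)) xs)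
                  (sym (filter-filter (R? i) (all? S) xs))

  length-none-∷ : ∀ xs i is →
    length (filter (none? is) xs) ≡ length (filter (none? is) (filter (R? i) xs)) + length (filter (none? (i ∷ is)) xs)
  length-none-∷ xs i is = trans (length-filter+length-filter-∁ (R? i) (filter (none? is) xs))
    (cong₂ _+_ (cong length (filter-comm (none? is) (R? i) xs))
               (cong length (trans (filter-filter (none? is) (∁? (R? i)) xs)
                                   (filter-⇔ (none? is ∩? ∁? (R? i)) (none? (i ∷ is)) none-∷⇔ xs))))
    where
    none-∷⇔ : ∀ x → (All (λ j → ¬ R j x) is × ¬ R i x) ⇔ All (λ j → ¬ R j x) (i ∷ is)
    none-∷⇔ _ = mk⇔ (λ (n , r) → r ∷ n) (swap ∘ All.uncons)

  inclusion-exclusion : ∀ is xs → Σℤ (sublists is) (signedCount xs) ≡ + length (filter (none? is) xs)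
  inclusion-exclusion [] xs = begin
    + 1 ℤ.* + length (filter (all? []) xs) ℤ.+ + 0  ≡⟨ ℤP.+-identityʳ _ ⟩
    + 1 ℤ.* + length (filter (all? []) xs)          ≡⟨ ℤP.*-identityˡ _ ⟩
    + length (filter (all? []) xs)                  ≡⟨ cong (+_ ∘ length) (filter-⇔ (all? []) (none? []) all-none xs) ⟩
    + length (filter (none? []) xs)                 ∎
    where
    all-none : ∀ x → All (λ i → R i x) [] ⇔ All (λ i → ¬ R i x) []
    all-none _ = mk⇔ (λ _ → []) (λ _ → [])
  inclusion-exclusion (i ∷ is) xs = begin
    Σℤ (map (i ∷_) (sublists is) ++ sublists is) f
      ≡⟨ Σℤ-++ (map (i ∷_) (sublists is)) (sublists is) f ⟩
    Σℤ (map (i ∷_) (sublists is)) f ℤ.+ Σℤ (sublists is) f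
      ≡⟨ cong (ℤ._+ Σℤ (sublists is) f) with-i ⟩
    - Σℤ (sublists is) g ℤ.+ Σℤ (sublists is) f
      ≡⟨ cong₂ (λ a b → - a ℤ.+ b) (inclusion-exclusion is Rxs) (inclusion-exclusion is xs) ⟩
    - + a ℤ.+ + length (filter (none? is) xs)
      ≡⟨ cong (λ b → - + a ℤ.+ + b) (length-none-∷ xs i is) ⟩
    - + a ℤ.+ + (a + b)
      ≡⟨ solve 2 (λ a b → :- a :+ (a :+ b) := b) refl (+ a) (+ b) ⟩
    + b ∎
    where
    open +-*-Solver
    Rxs = filter (R? i) xs
    f = signedCount xs
    g = signedCount Rxs
    a = length (filter (none? is) Rxs)
    b = length (filter (none? (i ∷ is)) xs)
    with-i : Σℤ (map (i ∷_) (sublists is)) f ≡ - Σℤ (sublists is) g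
    with-i = begin
      Σℤ (map (i ∷_) (sublists is)) f  ≡⟨ Σℤ-map (i ∷_) (sublists is) f ⟩
      Σℤ (sublists is) (f ∘ (i ∷_))    ≡⟨ Σℤ-cong (All.universal (signedCount-∷ xs i) (sublists is)) ⟩
      Σℤ (sublists is) (-_ ∘ g)        ≡⟨ Σℤ-neg (sublists is) g ⟩
      - Σℤ (sublists is) g             ∎

-- Divisibility and primes

-- No side condition is needed: x mod 0 = x, and 0 ∣ x iff x ≡ 0.
mod≡0⇔∣ : ∀ x m → x mod m ≡ 0 ⇔ m ∣ x
mod≡0⇔∣ x zero    = mk⇔ (λ x≡0 → subst (0 ∣_) (sym x≡0) ∣-refl) 0∣⇒≡0
mod≡0⇔∣ x (suc m) = m%n≡0⇔n∣m x (suc m)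

*-div : ∀ {D n} → D ∣ n → D * (n div D) ≡ n
*-div {zero}  D∣n = sym (0∣⇒≡0 D∣n)
*-div {suc D} D∣n = m*[n/m]≡n D∣n

div-unique : ∀ {D n m} → D ≢ 0 → n ≡ D * m → n div D ≡ m
div-unique {zero}         D≢0 _    = contradiction refl D≢0
div-unique {suc D} {m = m} _  refl = trans (cong (_div suc D) (*-comm (suc D) m)) (m*n/n≡m m (suc D))

sum-map-* : ∀ D s → sum (map (D *_) s) ≡ D * sum s
sum-map-* D []      = sym (*-zeroʳ D)
sum-map-* D (x ∷ s) = trans (cong (λ k → D * x + k) (sum-map-* D s)) (sym (*-distribˡ-+ D x (sum s)))

coprime∧∣⇒≡1 : ∀ {x n} → gcd x n ≡ 1 → n ∣ x → n ≡ 1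
coprime∧∣⇒≡1 {x} {n} g≡1 n∣x = ∣1⇒≡1 (subst (n ∣_) g≡1 (gcd-greatest n∣x ∣-refl))

coprime-∣-* : ∀ {m n x} → Coprime m n → m ∣ x → n ∣ x → m * n ∣ x
coprime-∣-* {m} {n} coprime m∣x n∣x = subst (_∣ _) lcm≡m*n (lcm-least m∣x n∣x)
  where
  lcm≡m*n : lcm m n ≡ m * n
  lcm≡m*n = begin
    lcm m n            ≡⟨ *-identityˡ (lcm m n) ⟨
    1 * lcm m n        ≡⟨ cong (_* lcm m n) (coprime⇒gcd≡1 coprime) ⟨
    gcd m n * lcm m n  ≡⟨ gcd*lcm m n ⟩
    m * n              ∎

prime≢0 : ∀ {p} → Prime p → p ≢ 0
prime≢0 {p} pr = ≢-nonZero⁻¹ p {{prime⇒nonZero pr}}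

prime≢1 : ∀ {p} → Prime p → p ≢ 1
prime≢1 pr = nonTrivial⇒≢1 {{prime⇒nonTrivial pr}}

prime∤⇒coprime : ∀ {p n} → Prime p → ¬ p ∣ n → Coprime p n
prime∤⇒coprime pr p∤n (i∣p , i∣n) with prime⇒irreducible pr i∣p
... | inj₁ i≡1  = i≡1
... | inj₂ refl = contradiction i∣n p∤n

prime∣prime⇒≡ : ∀ {p q} → Prime p → Prime q → q ∣ p → q ≡ p
prime∣prime⇒≡ pr qr q∣p with prime⇒irreducible pr q∣p
... | inj₁ q≡1 = contradiction q≡1 (prime≢1 qr)
... | inj₂ q≡p = q≡p

prime∣prime^⇒≡ : ∀ {p q} t → Prime p → Prime q → q ∣ p ^ t → q ≡ p
prime∣prime^⇒≡     zero    pr qr q∣1       = contradiction (∣1⇒≡1 q∣1) (prime≢1 qr)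
prime∣prime^⇒≡ {p} (suc t) pr qr q∣p^[1+t] with euclidsLemma p (p ^ t) qr q∣p^[1+t]
... | inj₁ q∣p   = prime∣prime⇒≡ pr qr q∣p
... | inj₂ q∣p^t = prime∣prime^⇒≡ t pr qr q∣p^t

prime∣prime*prime⇒≡ : ∀ {p₁ p₂ q} → Prime p₁ → Prime p₂ → Prime q → q ∣ p₁ * p₂ → q ≡ p₁ ⊎ q ≡ p₂
prime∣prime*prime⇒≡ {p₁} {p₂} pr₁ pr₂ qr q∣p₁p₂ with euclidsLemma p₁ p₂ qr q∣p₁p₂
... | inj₁ q∣p₁ = inj₁ (prime∣prime⇒≡ pr₁ qr q∣p₁)
... | inj₂ q∣p₂ = inj₂ (prime∣prime⇒≡ pr₂ qr q∣p₂)

∃-prime-∣ : ∀ {n} → n ≢ 0 → n ≢ 1 → ∃[ p ] Prime p × p ∣ n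
∃-prime-∣ {zero}  n≢0 _   = contradiction refl n≢0
∃-prime-∣ {suc n} _   n≢1 with factorise (suc n)
... | record { factors = [] ; isFactorisation = n≡1 } = contradiction n≡1 n≢1
... | record { factors = p ∷ ps ; isFactorisation = n≡∏ ; factorsPrime = pr ∷ _ } =
  p , pr , subst (p ∣_) (sym n≡∏) (m∣m*n (product ps))

product-∣ : ∀ {S x} → All Prime S → Unique S → All (_∣ x) S → product S ∣ x
product-∣ {[]}    []         []            []          = 1∣ _
product-∣ {p ∷ S} (pr ∷ prs) (p∉S ∷ uniq) (p∣x ∷ S∣x) =
  coprime-∣-* (prime∤⇒coprime pr p∤∏S) p∣x (product-∣ prs uniq S∣x)
  where
  p∤∏S : ¬ p ∣ product S
  p∤∏S p∣∏S = All.lookup p∉S (factorisationHasAllPrimeFactors pr p∣∏S prs) refl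

filter-∣-applyUpTo : ∀ D {a} .{{_ : NonZero D}} → D ∣ a → filter (D ∣?_) (applyUpTo (λ i → a + i) D) ≡ [ a ]
filter-∣-applyUpTo (suc D) {a} D∣a = begin
  filter (suc D ∣?_) (a + 0 ∷ applyUpTo (λ i → a + suc i) D)
    ≡⟨ filter-accept (suc D ∣?_) (subst (suc D ∣_) (sym (+-identityʳ a)) D∣a) ⟩
  a + 0 ∷ filter (suc D ∣?_) (applyUpTo (λ i → a + suc i) D)
    ≡⟨ cong₂ _∷_ (+-identityʳ a) (filter-none (suc D ∣?_) (All.applyUpTo⁺₁ _ D D∤a+1+i)) ⟩
  [ a ] ∎
  where
  D∤a+1+i : ∀ {i} → i < D → ¬ suc D ∣ a + suc i
  D∤a+1+i i<D D∣a+1+i = <⇒≱ (s≤s i<D) (∣⇒≤ (∣m+n∣m⇒∣n D∣a+1+i D∣a))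

filter-∣-upTo : ∀ D m .{{_ : NonZero D}} → filter (D ∣?_) (upTo (D * m)) ≡ map (D *_) (upTo m)
filter-∣-upTo D zero    = cong (filter (D ∣?_) ∘ upTo) (*-zeroʳ D)
filter-∣-upTo D (suc m) = begin
  filter (D ∣?_) (upTo (D * suc m))
    ≡⟨ cong (filter (D ∣?_) ∘ upTo) (trans (*-suc D m) (+-comm D (D * m))) ⟩
  filter (D ∣?_) (upTo (D * m + D))
    ≡⟨ cong (filter (D ∣?_)) (applyUpTo-+ id (D * m) D) ⟩
  filter (D ∣?_) (upTo (D * m) ++ applyUpTo (λ i → D * m + i) D)
    ≡⟨ filter-++ (D ∣?_) (upTo (D * m)) _ ⟩
  filter (D ∣?_) (upTo (D * m)) ++ filter (D ∣?_) (applyUpTo (λ i → D * m + i) D)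
    ≡⟨ cong₂ _++_ (filter-∣-upTo D m) (filter-∣-applyUpTo D (m∣m*n m)) ⟩
  map (D *_) (upTo m) ++ map (D *_) [ m ]
    ≡⟨ map-++ (D *_) (upTo m) [ m ] ⟨
  map (D *_) (upTo m ∷ʳ m)
    ≡⟨ cong (map (D *_)) (upTo-∷ʳ m) ⟩
  map (D *_) (upTo (suc m)) ∎

DividesAll : ℕ → ∀ {d} → Vec ℕ d → Set
DividesAll c v = All (c ∣_) (toList v)

dividesAll? : ∀ c {d} → Decidable (DividesAll c {d})
dividesAll? c v = All.all? (c ∣?_) (toList v)

module _ {d : ℕ} where

  infixr 5 _⊗_ _⊗?_

  -- tuples m (suc d) is upTo m ⊗ tuples m d by definition.
  _⊗_ : List A → List (Vec A d) → List (Vec A (suc d))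
  xs ⊗ vs = concatMap (λ x → map (x ∷_) vs) xs

  _⊗?_ : {Q : Pred (Vec A d) 0ℓ} → Decidable P → Decidable Q → Decidable (λ v → P (V.head v) × Q (V.tail v))
  (P? ⊗? Q?) v = P? (V.head v) ×-dec Q? (V.tail v)

  filter-⊗ : {Q : Pred (Vec A d) 0ℓ} (P? : Decidable P) (Q? : Decidable Q) →
    ∀ xs vs → filter (P? ⊗? Q?) (xs ⊗ vs) ≡ filter P? xs ⊗ filter Q? vs
  filter-⊗ P? Q? []       vs = refl
  filter-⊗ P? Q? (x ∷ xs) vs with P? x
  ... | yes px = trans (filter-++ (P? ⊗? Q?) (map (x ∷_) vs) (xs ⊗ vs)) (cong₂ _++_ accepted (filter-⊗ P? Q? xs vs))
    where
    accepted : filter (P? ⊗? Q?) (map (x ∷_) vs) ≡ map (x ∷_) (filter Q? vs)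
    accepted = trans (filter-map (P? ⊗? Q?) (x ∷_) vs)
                     (cong (map (x ∷_)) (filter-⇔ ((P? ⊗? Q?) ∘ (x ∷_)) Q? (λ _ → mk⇔ proj₂ (px ,_)) vs))
  ... | no ¬px = trans (filter-++ (P? ⊗? Q?) (map (x ∷_) vs) (xs ⊗ vs))
                       (trans (cong (_++ _) rejected) (filter-⊗ P? Q? xs vs))
    where
    rejected : filter (P? ⊗? Q?) (map (x ∷_) vs) ≡ []
    rejected = filter-none (P? ⊗? Q?) (All.map⁺ (All.universal (λ _ → ¬px ∘ proj₁) vs))

  map-⊗ : (f : A → A) → ∀ xs vs → map (V.map f) (xs ⊗ vs) ≡ map f xs ⊗ map (V.map f) vs
  map-⊗ f []       vs = refl
  map-⊗ f (x ∷ xs) vs = trans (map-++ (V.map f) (map (x ∷_) vs) (xs ⊗ vs))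
                              (cong₂ _++_ (trans (sym (map-∘ vs)) (map-∘ vs)) (map-⊗ f xs vs))

⊗-[[]] : (xs : List A) → xs ⊗ ([] ∷ []) ≡ map (_∷ []) xs
⊗-[[]] []       = refl
⊗-[[]] (x ∷ xs) = cong ((x ∷ []) ∷_) (⊗-[[]] xs)

count-tuples₁ : {P : Pred (Vec ℕ 1) 0ℓ} (P? : Decidable P) →
  ∀ m → length (filter P? (tuples m 1)) ≡ length (filter (P? ∘ (_∷ [])) (upTo m))
count-tuples₁ P? m = begin
  length (filter P? (upTo m ⊗ ([] ∷ [])))               ≡⟨ cong (length ∘ filter P?) (⊗-[[]] (upTo m)) ⟩
  length (filter P? (map (_∷ []) (upTo m)))              ≡⟨ cong length (filter-map P? (_∷ []) (upTo m)) ⟩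
  length (map (_∷ []) (filter (P? ∘ (_∷ [])) (upTo m)))  ≡⟨ length-map (_∷ []) (filter (P? ∘ (_∷ [])) (upTo m)) ⟩
  length (filter (P? ∘ (_∷ [])) (upTo m))                ∎

tuples-dividesAll : ∀ D m d .{{_ : NonZero D}} →
  filter (dividesAll? D) (tuples (D * m) d) ≡ map (V.map (D *_)) (tuples m d)
tuples-dividesAll D m zero    = refl
tuples-dividesAll D m (suc d) = begin
  filter (dividesAll? D) (upTo (D * m) ⊗ tuples (D * m) d)
    ≡⟨ filter-⇔ (dividesAll? D) ((D ∣?_) ⊗? dividesAll? D) head-tail (upTo (D * m) ⊗ tuples (D * m) d) ⟩
  filter ((D ∣?_) ⊗? dividesAll? D) (upTo (D * m) ⊗ tuples (D * m) d)
    ≡⟨ filter-⊗ (D ∣?_) (dividesAll? D) (upTo (D * m)) (tuples (D * m) d) ⟩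
  filter (D ∣?_) (upTo (D * m)) ⊗ filter (dividesAll? D) (tuples (D * m) d)
    ≡⟨ cong₂ _⊗_ (filter-∣-upTo D m) (tuples-dividesAll D m d) ⟩
  map (D *_) (upTo m) ⊗ map (V.map (D *_)) (tuples m d)
    ≡⟨ map-⊗ (D *_) (upTo m) (tuples m d) ⟨
  map (V.map (D *_)) (tuples m (suc d)) ∎
  where
  head-tail : ∀ (v : Vec ℕ (suc d)) → DividesAll D v ⇔ (D ∣ V.head v × DividesAll D (V.tail v))
  head-tail (_ ∷ _) = mk⇔ All.uncons (λ (D∣x , D∣v) → D∣x ∷ D∣v)

mod-*-cancel : ∀ D {m} x .{{_ : NonZero D}} → (D * x) mod (D * m) ≡ 0 ⇔ x mod m ≡ 0
mod-*-cancel D {m} x =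
  ⇔.trans (mod≡0⇔∣ (D * x) (D * m)) (⇔.trans (mk⇔ (*-cancelˡ-∣ D) (*-monoʳ-∣ D)) (⇔.sym (mod≡0⇔∣ x m)))

zeroSumFree-scale : ∀ D {m d} .{{_ : NonZero D}} (v : Vec ℕ d) →
  ZeroSumFree (D * m) (V.map (D *_) v) ⇔ ZeroSumFree m v
zeroSumFree-scale D {m} v = mk⇔
  (λ zsf → All.map (λ {s} s≢0 → s≢0 ∘ from (scaled s)) (All.map⁻ (subst (All _) subsets zsf)))
  (λ zsf → subst (All _) (sym subsets) (All.map⁺ (All.map (λ {s} s≢0 → s≢0 ∘ to (scaled s)) zsf)))
  where
  subsets : nonemptySubsets (toList (V.map (D *_) v)) ≡ map (map (D *_)) (nonemptySubsets (toList v))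
  subsets = trans (cong nonemptySubsets (toList-map (D *_) v)) (nonemptySubsets-map (D *_) (toList v))
  scaled : ∀ s → sum (map (D *_) s) mod (D * m) ≡ 0 ⇔ sum s mod m ≡ 0
  scaled s = subst (λ k → k mod (D * m) ≡ 0 ⇔ _) (sym (sum-map-* D s)) (mod-*-cancel D (sum s))

count-zeroSumFree-dividesAll : ∀ {D m n} d .{{_ : NonZero D}} → n ≡ D * m →
  length (filter (zeroSumFree? n) (filter (dividesAll? D) (tuples n d))) ≡ α m d
count-zeroSumFree-dividesAll {D} {m} d refl = begin
  length (filter (zeroSumFree? (D * m)) (filter (dividesAll? D) (tuples (D * m) d)))
    ≡⟨ cong (length ∘ filter (zeroSumFree? (D * m))) (tuples-dividesAll D m d) ⟩
  length (filter (zeroSumFree? (D * m)) (map (V.map (D *_)) (tuples m d)))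
    ≡⟨ cong length (filter-map (zeroSumFree? (D * m)) (V.map (D *_)) (tuples m d)) ⟩
  length (map (V.map (D *_)) (filter (zeroSumFree? (D * m) ∘ V.map (D *_)) (tuples m d)))
    ≡⟨ length-map (V.map (D *_)) (filter (zeroSumFree? (D * m) ∘ V.map (D *_)) (tuples m d)) ⟩
  length (filter (zeroSumFree? (D * m) ∘ V.map (D *_)) (tuples m d))
    ≡⟨ cong length (filter-⇔ _ (zeroSumFree? m) (zeroSumFree-scale D) (tuples m d)) ⟩
  α m d ∎

zeroSumFree-[x]⇔ : ∀ m x → ZeroSumFree m (x ∷ []) ⇔ (¬ m ∣ x)
zeroSumFree-[x]⇔ m x = mk⇔
  (λ { (x≢0 ∷ []) m∣x → x≢0 (from (mod≡0⇔∣ (x + 0) m) (subst (m ∣_) (sym (+-identityʳ x)) m∣x)) })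
  (λ m∤x → (λ x≡0 → m∤x (subst (m ∣_) (+-identityʳ x) (to (mod≡0⇔∣ (x + 0) m) x≡0))) ∷ [])

¬zeroSumFree-mod-1 : ∀ {d} (v : Vec ℕ (suc d)) → ¬ ZeroSumFree 1 v
¬zeroSumFree-mod-1 v@(_ ∷ _) zsf =
  All.lookup zsf (∈-filter⁺ nonempty? (∈-sublists (toList v)) (s≤s z≤n)) (n%1≡0 (sum (toList v)))

α[1,1+d]≡0 : ∀ d → α 1 (suc d) ≡ 0
α[1,1+d]≡0 d = cong length (filter-none (zeroSumFree? 1) (All.universal ¬zeroSumFree-mod-1 (tuples 1 (suc d))))

α[1+k,1]≡k : ∀ k → α (suc k) 1 ≡ k
α[1+k,1]≡k k = begin
  α m 1
    ≡⟨ count-tuples₁ (zeroSumFree? m) m ⟩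
  length (filter (zeroSumFree? m ∘ (_∷ [])) (upTo m))
    ≡⟨ cong length (filter-⇔ (zeroSumFree? m ∘ (_∷ [])) m∤? (zeroSumFree-[x]⇔ m) (upTo m)) ⟩
  length (filter m∤? (0 ∷ applyUpTo suc k))
    ≡⟨ cong length (filter-reject m∤? {xs = applyUpTo suc k} (λ m∤0 → m∤0 (m ∣0))) ⟩
  length (filter m∤? (applyUpTo suc k))
    ≡⟨ cong length (filter-all m∤? (All.applyUpTo⁺₁ suc k m∤1+i)) ⟩
  length (applyUpTo suc k)
    ≡⟨ length-applyUpTo suc k ⟩
  k ∎
  where
  m = suc k
  m∤? = ¬? ∘ (m ∣?_)
  m∤1+i : ∀ {i} → i < k → ¬ m ∣ suc i
  m∤1+i i<k m∣1+i = <⇒≱ (s≤s i<k) (∣⇒≤ m∣1+i)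

+α[m,1]≡m-1 : ∀ {m} → m ≢ 0 → + α m 1 ≡ + m ℤ.- + 1
+α[m,1]≡m-1 {zero}  m≢0 = contradiction refl m≢0
+α[m,1]≡m-1 {suc k} _   = cong +_ (α[1+k,1]≡k k)

φ≡β[n,1] : ∀ {n} → 2 ≤ n → φ n ≡ β n 1
φ≡β[n,1] {suc (suc k)} (s≤s (s≤s z≤n)) = begin
  length (filter C? (map suc (upTo n)))
    ≡⟨ cong (length ∘ filter C?) (trans (map-upTo suc n) (sym (applyUpTo-∷ʳ suc (suc k)))) ⟩
  length (filter C? (nonzeroResidues ∷ʳ n))
    ≡⟨ cong length (filter-++ C? nonzeroResidues [ n ]) ⟩
  length (filter C? nonzeroResidues ++ filter C? [ n ])
    ≡⟨ cong (λ L → length (filter C? nonzeroResidues ++ L)) (filter-reject C? {x = n} {xs = []} n-not-coprime) ⟩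
  length (filter C? nonzeroResidues ++ [])
    ≡⟨ cong length (++-identityʳ (filter C? nonzeroResidues)) ⟩
  length (filter C? nonzeroResidues)
    ≡⟨ cong length (filter-reject C? {x = 0} {xs = nonzeroResidues} 0-not-coprime) ⟨
  length (filter C? (upTo n))
    ≡⟨ cong length (filter-⇔ C? (λ x → zeroSumFree? n (x ∷ []) ×-dec gcdOne? n (x ∷ [])) coprime⇔ (upTo n)) ⟩
  length (filter (λ x → zeroSumFree? n (x ∷ []) ×-dec gcdOne? n (x ∷ [])) (upTo n))
    ≡⟨ count-tuples₁ (λ v → zeroSumFree? n v ×-dec gcdOne? n v) n ⟨
  β n 1 ∎
  where
  n = suc (suc k)
  nonzeroResidues = applyUpTo suc (suc k)
  C? = λ x → gcd x n ≟ 1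
  n≢1 : n ≢ 1
  n≢1 ()
  n-not-coprime : gcd n n ≢ 1
  n-not-coprime c = n≢1 (coprime∧∣⇒≡1 c ∣-refl)
  0-not-coprime : gcd 0 n ≢ 1
  0-not-coprime c = n≢1 (coprime∧∣⇒≡1 c (n ∣0))
  coprime⇔ : ∀ x → gcd x n ≡ 1 ⇔ (ZeroSumFree n (x ∷ []) × GcdOne n (x ∷ []))
  coprime⇔ x = mk⇔ (λ c → from (zeroSumFree-[x]⇔ n x) (n≢1 ∘ coprime∧∣⇒≡1 c) , c) proj₂

DistinctPrimeDivisors : ℕ → List ℕ → Set
DistinctPrimeDivisors n S = All (λ p → Prime p × p ∣ n) S × Unique S

-- Any duplicate-free list of all prime divisors of n will do; parts (ii) and (iii) use [ p ] and
-- p₁ ∷ p₂ ∷ [] instead of computing primeDivisors.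
record PrimeDivisorsOf (n : ℕ) (ps : List ℕ) : Set where
  field
    distinct : DistinctPrimeDivisors n ps
    complete : ∀ {p} → Prime p → p ∣ n → p ∈ ps

sublists-distinct : ∀ {n ps} → DistinctPrimeDivisors n ps → All (DistinctPrimeDivisors n) (sublists ps)
sublists-distinct (divisors , unique) = All.zip (sublists⁺ divisors , sublists-Unique⁺ unique)

product*nS≡ : ∀ {n S} → DistinctPrimeDivisors n S → product S * nS n S ≡ n
product*nS≡ (divisors , unique) = *-div (product-∣ (All.map proj₁ divisors) unique (All.map proj₂ divisors))

∣-foldr-gcd⇔ : ∀ {c} n {d} (v : Vec ℕ d) → c ∣ V.foldr (λ _ → ℕ) gcd n v ⇔ (c ∣ n × DividesAll c v)
∣-foldr-gcd⇔ n []      = mk⇔ (_, []) proj₁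
∣-foldr-gcd⇔ n (x ∷ v) = mk⇔
  (λ c∣g → let c∣n , c∣v = to (∣-foldr-gcd⇔ n v) (∣-trans c∣g (gcd[m,n]∣n x _))
           in c∣n , ∣-trans c∣g (gcd[m,n]∣m x _) ∷ c∣v)
  (λ { (c∣n , c∣x ∷ c∣v) → gcd-greatest c∣x (from (∣-foldr-gcd⇔ n v) (c∣n , c∣v)) })

product-dividesAll⇔ : ∀ {S d} {v : Vec ℕ d} → All Prime S → Unique S →
  All (λ p → DividesAll p v) S ⇔ DividesAll (product S) v
product-dividesAll⇔ prs unique = mk⇔
  (λ S∣v → All.tabulate (λ x∈v → product-∣ prs unique (All.map (λ p∣v → All.lookup p∣v x∈v) S∣v)))
  (λ ∏S∣v → All.tabulate (λ p∈S → All.map (∣-trans (∈⇒∣product p∈S)) ∏S∣v))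

gcdOne⇔none-dividesAll : ∀ {n ps d} (v : Vec ℕ d) → n ≢ 0 → PrimeDivisorsOf n ps →
  GcdOne n v ⇔ All (λ p → ¬ DividesAll p v) ps
gcdOne⇔none-dividesAll {n} v n≢0 pd = mk⇔
  (λ g≡1 → All.map (λ (pr , p∣n) p∣v → prime≢1 pr (∣1⇒≡1 (subst (_ ∣_) g≡1 (from (∣-foldr-gcd⇔ n v) (p∣n , p∣v)))))
                   (proj₁ distinct))
  (λ none → decidable-stable (g ≟ 1) λ g≢1 →
    let q , qr , q∣g = ∃-prime-∣ g≢0 g≢1
        q∣n , q∣v   = to (∣-foldr-gcd⇔ n v) q∣g
    in All.lookup none (complete qr q∣n) q∣v)
  where
  open PrimeDivisorsOf pd
  g = V.foldr (λ _ → ℕ) gcd n v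
  g≢0 : g ≢ 0
  g≢0 g≡0 = n≢0 (0∣⇒≡0 (subst (_∣ n) g≡0 (proj₁ (to (∣-foldr-gcd⇔ n v) ∣-refl))))

primeDivisors-PrimeDivisorsOf : ∀ {n} → n ≢ 0 → PrimeDivisorsOf n (primeDivisors n)
primeDivisors-PrimeDivisorsOf {n} n≢0 = record
  { distinct = All.tabulate (proj₂ ∘ ∈-filter⁻ primeDivisor? {xs = upTo (suc n)})
             , Unique.filter⁺ primeDivisor? (Unique.upTo⁺ (suc n))
  ; complete = λ pr p∣n → ∈-filter⁺ primeDivisor? (∈-upTo⁺ (s≤s (∣⇒≤ {{≢-nonZero n≢0}} p∣n))) (pr , p∣n)
  }
  where
  primeDivisor? = λ p → prime? p ×-dec p ∣? n

prime^-PrimeDivisorsOf : ∀ {p} t → Prime p → PrimeDivisorsOf (p ^ suc t) [ p ]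
prime^-PrimeDivisorsOf {p} t pr = record
  { distinct = ((pr , m∣m*n (p ^ t)) ∷ []) , ([] ∷ [])
  ; complete = λ qr q∣p^[1+t] → here (prime∣prime^⇒≡ (suc t) pr qr q∣p^[1+t])
  }

prime*prime-PrimeDivisorsOf : ∀ {p₁ p₂} → Prime p₁ → Prime p₂ → p₁ ≢ p₂ →
  PrimeDivisorsOf (p₁ * p₂) (p₁ ∷ p₂ ∷ [])
prime*prime-PrimeDivisorsOf {p₁} {p₂} pr₁ pr₂ p₁≢p₂ = record
  { distinct = ((pr₁ , m∣m*n p₂) ∷ (pr₂ , n∣m*n p₁) ∷ []) , ((p₁≢p₂ ∷ []) ∷ [] ∷ [])
  ; complete = λ qr q∣p₁p₂ → case prime∣prime*prime⇒≡ pr₁ pr₂ qr q∣p₁p₂ of λ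
      { (inj₁ q≡p₁) → here q≡p₁
      ; (inj₂ q≡p₂) → there (here q≡p₂)
      }
  }

-- Inclusion–exclusion for α and β

module _ (d : ℕ) where

  open InclusionExclusion {R = λ p → DividesAll p {d}} (λ p → dividesAll? p)

  count-all-dividesAll : ∀ {n S} → DistinctPrimeDivisors n S →
    length (filter (all? S) (filter (zeroSumFree? n) (tuples n d))) ≡ α (nS n S) d
  count-all-dividesAll {n} {S} distinct@(divisors , unique) = begin
    length (filter (all? S) (filter (zeroSumFree? n) T))
      ≡⟨ cong length (filter-comm (zeroSumFree? n) (all? S) T) ⟩
    length (filter (zeroSumFree? n) (filter (all? S) T))
      ≡⟨ cong (length ∘ filter (zeroSumFree? n)) (filter-⇔ (all? S) (dividesAll? (product S)) S∣⇔∏S∣ T) ⟩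
    length (filter (zeroSumFree? n) (filter (dividesAll? (product S)) T))
      ≡⟨ count-zeroSumFree-dividesAll d {{productOfPrimes≢0 primes}} (sym (product*nS≡ distinct)) ⟩
    α (nS n S) d ∎
    where
    T = tuples n d
    primes = All.map proj₁ divisors
    S∣⇔∏S∣ : (v : Vec ℕ d) → All (λ p → DividesAll p v) S ⇔ DividesAll (product S) v
    S∣⇔∏S∣ _ = product-dividesAll⇔ primes unique

  β-inclusion-exclusion : ∀ {n ps} → n ≢ 0 → PrimeDivisorsOf n ps →
    + β n d ≡ Σℤ (sublists ps) (λ S → neg1^ (length S) ℤ.* + α (nS n S) d)
  β-inclusion-exclusion {n} {ps} n≢0 pd = begin
    + β n d
      ≡⟨ cong (+_ ∘ length) (filter-filter (zeroSumFree? n) (gcdOne? n) (tuples n d)) ⟨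
    + length (filter (gcdOne? n) Z)
      ≡⟨ cong (+_ ∘ length) (filter-⇔ (gcdOne? n) (none? ps) (λ v → gcdOne⇔none-dividesAll v n≢0 pd) Z) ⟩
    + length (filter (none? ps) Z)
      ≡⟨ inclusion-exclusion ps Z ⟨
    Σℤ (sublists ps) (signedCount Z)
      ≡⟨ Σℤ-cong (All.map (λ {S} distinct → cong (λ c → neg1^ (length S) ℤ.* + c) (count-all-dividesAll distinct))
                         (sublists-distinct (PrimeDivisorsOf.distinct pd))) ⟩
    Σℤ (sublists ps) (λ S → neg1^ (length S) ℤ.* + α (nS n S) d) ∎
    where Z = filter (zeroSumFree? n) (tuples n d)

  α-inclusion-exclusion : ∀ {n ps} → n ≢ 0 → PrimeDivisorsOf n ps →
    + α n d ≡ + β n d ℤ.+ Σℤ (nonemptySubsets ps) (λ S → neg1^ (suc (length S)) ℤ.* + α (nS n S) d)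
  α-inclusion-exclusion {n} {ps} n≢0 pd = begin
    + α n d
      ≡⟨ solve 2 (λ a x → a := x :+ a :+ :- x) refl (+ α n d) X ⟩
    X ℤ.+ + α n d ℤ.+ - X
      ≡⟨ cong₂ ℤ._+_ β≡X+α (Σℤ-neg (nonemptySubsets ps) f) ⟨
    + β n d ℤ.+ Σℤ (nonemptySubsets ps) (-_ ∘ f)
      ≡⟨ cong (λ y → + β n d ℤ.+ y) (Σℤ-cong (All.universal -f≡ (nonemptySubsets ps))) ⟩
    + β n d ℤ.+ Σℤ (nonemptySubsets ps) (λ S → neg1^ (suc (length S)) ℤ.* + α (nS n S) d) ∎
    where
    open +-*-Solver
    f : List ℕ → ℤ
    f S = neg1^ (length S) ℤ.* + α (nS n S) d
    X = Σℤ (nonemptySubsets ps) f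
    f[]≡α : f [] ≡ + α n d
    f[]≡α = trans (ℤP.*-identityˡ _) (cong (λ m → + α m d) (n/1≡n n))
    β≡X+α : + β n d ≡ X ℤ.+ + α n d
    β≡X+α = trans (β-inclusion-exclusion n≢0 pd) (trans (Σℤ-sublists ps f) (cong (λ y → X ℤ.+ y) f[]≡α))
    -f≡ : ∀ S → - f S ≡ neg1^ (suc (length S)) ℤ.* + α (nS n S) d
    -f≡ S = ℤP.neg-distribˡ-* (neg1^ (length S)) _

β[n,1]-inclusion-exclusion : ∀ {n ps} → n ≢ 0 → PrimeDivisorsOf n ps →
  + β n 1 ≡ Σℤ (sublists ps) (λ S → neg1^ (length S) ℤ.* (+ nS n S ℤ.- + 1))
β[n,1]-inclusion-exclusion {n} n≢0 pd = trans (β-inclusion-exclusion 1 n≢0 pd)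
  (Σℤ-cong (All.map (λ {S} distinct → cong (neg1^ (length S) ℤ.*_) (+α[m,1]≡m-1 (nS≢0 distinct)))
                    (sublists-distinct (PrimeDivisorsOf.distinct pd))))
  where
  nS≢0 : ∀ {S} → DistinctPrimeDivisors n S → nS n S ≢ 0
  nS≢0 {S} distinct nS≡0 = n≢0 (begin
    n                  ≡⟨ product*nS≡ distinct ⟨
    product S * nS n S ≡⟨ cong (product S *_) nS≡0 ⟩
    product S * 0      ≡⟨ *-zeroʳ (product S) ⟩
    0                  ∎)

nS[p]≡ : ∀ {n p m} → Prime p → n ≡ p * m → nS n [ p ] ≡ m
nS[p]≡ {p = p} pr n≡pm =
  div-unique (prime≢0 pr ∘ trans (sym (*-identityʳ p))) (trans n≡pm (cong (_* _) (sym (*-identityʳ p))))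

α-prime-power : ∀ {p t} d → Prime p → 1 ≤ t → α (p ^ t) d ≡ β (p ^ t) d + α (p ^ (t ∸ 1)) d
α-prime-power {p} {suc t} d pr _ = ℤP.+-injective (begin
  + α N d                             ≡⟨ α-inclusion-exclusion d N≢0 (prime^-PrimeDivisorsOf t pr) ⟩
  + β N d ℤ.+ (term [ p ] ℤ.+ + 0)    ≡⟨ cong (λ x → + β N d ℤ.+ (x ℤ.+ + 0)) term[p] ⟩
  + β N d ℤ.+ (+ α (p ^ t) d ℤ.+ + 0) ≡⟨ cong (λ x → + β N d ℤ.+ x) (ℤP.+-identityʳ (+ α (p ^ t) d)) ⟩
  + (β N d + α (p ^ t) d)             ∎)
  where
  N = p ^ suc t
  N≢0 : N ≢ 0
  N≢0 = prime≢0 pr ∘ m^n≡0⇒m≡0 p (suc t)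
  term : List ℕ → ℤ
  term S = neg1^ (suc (length S)) ℤ.* + α (nS N S) d
  term[p] : term [ p ] ≡ + α (p ^ t) d
  term[p] = trans (ℤP.*-identityˡ _) (cong (λ m → + α m d) (nS[p]≡ pr refl))

α-prime*prime : ∀ {p₁ p₂} d → Prime p₁ → Prime p₂ → p₁ ≢ p₂ → 1 ≤ d →
  α (p₁ * p₂) d ≡ β (p₁ * p₂) d + α p₁ d + α p₂ d
α-prime*prime {p₁} {p₂} d@(suc d-1) pr₁ pr₂ p₁≢p₂ _ = ℤP.+-injective (begin
  + α N d
    ≡⟨ α-inclusion-exclusion d N≢0 (prime*prime-PrimeDivisorsOf pr₁ pr₂ p₁≢p₂) ⟩
  + β N d ℤ.+ (term (p₁ ∷ p₂ ∷ []) ℤ.+ (term [ p₁ ] ℤ.+ (term [ p₂ ] ℤ.+ + 0)))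
    ≡⟨ cong₂ (λ x y → + β N d ℤ.+ (x ℤ.+ y)) term[p₁p₂] (cong₂ (λ x y → x ℤ.+ (y ℤ.+ + 0)) term[p₁] term[p₂]) ⟩
  + β N d ℤ.+ (+ 0 ℤ.+ (+ α p₂ d ℤ.+ (+ α p₁ d ℤ.+ + 0)))
    ≡⟨ solve 3 (λ b a₁ a₂ → b :+ (con (+ 0) :+ (a₂ :+ (a₁ :+ con (+ 0)))) := b :+ a₁ :+ a₂)
             refl (+ β N d) (+ α p₁ d) (+ α p₂ d) ⟩
  + (β N d + α p₁ d + α p₂ d) ∎)
  where
  open +-*-Solver
  N = p₁ * p₂
  N≢0 : N ≢ 0
  N≢0 N≡0 = [ prime≢0 pr₁ , prime≢0 pr₂ ]′ (m*n≡0⇒m≡0∨n≡0 p₁ N≡0)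
  term : List ℕ → ℤ
  term S = neg1^ (suc (length S)) ℤ.* + α (nS N S) d
  term[p₁p₂] : term (p₁ ∷ p₂ ∷ []) ≡ + 0
  term[p₁p₂] = trans (cong (λ m → neg1^ 3 ℤ.* + α m d) nS≡1) (cong (λ a → neg1^ 3 ℤ.* + a) (α[1,1+d]≡0 d-1))
    where
    nS≡1 : nS N (p₁ ∷ p₂ ∷ []) ≡ 1
    nS≡1 = div-unique (N≢0 ∘ trans (cong (p₁ *_) (sym (*-identityʳ p₂))))
                      (trans (cong (p₁ *_) (sym (*-identityʳ p₂))) (sym (*-identityʳ _)))
  term[p₁] : term [ p₁ ] ≡ + α p₂ d
  term[p₁] = trans (ℤP.*-identityˡ _) (cong (λ m → + α m d) (nS[p]≡ pr₁ refl))
  term[p₂] : term [ p₂ ] ≡ + α p₁ d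
  term[p₂] = trans (ℤP.*-identityˡ _) (cong (λ m → + α m d) (nS[p]≡ pr₂ (*-comm p₁ p₂)))

-- Parts (ii) and (iii) hold for every prime power and every product of two distinct primes.
corollary2p3 : (n d : ℕ) → 3 ≤ n → 1 ≤ d → d < n →
    ((+ α n d) ≡ (+ β n d) ℤ.+ Σℤ (nonemptySubsets (primeDivisors n)) (λ S → neg1^ (suc (length S)) ℤ.* (+ α (nS n S) d)))
    × ((+ β n d) ≡ Σℤ (sublists (primeDivisors n)) (λ S → neg1^ (length S) ℤ.* (+ α (nS n S) d)))
    × (φ n ≡ β n 1)
    × ((+ β n 1) ≡ Σℤ (sublists (primeDivisors n)) (λ S → neg1^ (length S) ℤ.* (+ (nS n S) ℤ.- + 1)))
    × ((p t : ℕ) → Prime p → 1 ≤ t → n ≡ p ^ t → α (p ^ t) d ≡ β (p ^ t) d + α (p ^ (t ∸ 1)) d)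
    × ((p₁ p₂ : ℕ) → Prime p₁ → Prime p₂ → p₁ ≢ p₂ → n ≡ p₁ * p₂ → α (p₁ * p₂) d ≡ β (p₁ * p₂) d + α p₁ d + α p₂ d)
corollary2p3 n d 3≤n@(s≤s _) 1≤d _ =
  α-inclusion-exclusion d n≢0 pd ,
  β-inclusion-exclusion d n≢0 pd ,
  φ≡β[n,1] (≤-trans (s≤s (s≤s z≤n)) 3≤n) ,
  β[n,1]-inclusion-exclusion n≢0 pd ,
  (λ _ _ pr 1≤t _ → α-prime-power d pr 1≤t) ,
  (λ _ _ pr₁ pr₂ p₁≢p₂ _ → α-prime*prime d pr₁ pr₂ p₁≢p₂ 1≤d)
  where
  n≢0 : n ≢ 0
  n≢0 ()
  pd : PrimeDivisorsOf n (primeDivisors n)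
  pd = primeDivisors-PrimeDivisorsOf n≢0
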